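{- Let $\mathcal V$ be a type universe. (i) One can give a nontrivial small $\delta_{\mathcal V}$-complete poset (with carrier and order living in some type universes) if and only if $\Omega_{\neg\neg}$-$\mathrm{Resizing}_{\mathcal V}$ holds, i.e. the type $\Omega_{\neg\neg,\mathcal V}$ of $\neg\neg$-stable propositions in $\mathcal V$ is $\mathcal V$-small. (ii) One can give a positive small $\delta_{\mathcal V}$-complete poset if and only if $\Omega$-$\mathrm{Resizing}_{\mathcal V}$ holds, i.e. the type $\Omega_{\mathcal V}$ of propositions in $\mathcal V$ is $\mathcal V$-small.
   Context: Setting: intensional Martin-Löf type theory (univalent foundations) with $\Sigma,\Pi$, identity types, $+$, $\mathbf 0,\mathbf 1,\mathbb N$, and a hierarchy of non-cumulative type universes (with successor $\mathcal V^+$ and join $\mathcal U\sqcup\mathcal V$), assuming function extensionality, propositional extensionality and propositional truncations $\|X\|$ (in the same universe as $X$, eliminating into propositions of any universe). Excluded middle, choice and propositional resizing are not assumed. A proposition is a type any two of whose elements are equal; $\Omega_{\mathcal V}:=\Sigma_{P:\mathcal V}\,\mathrm{isProp}(P)$ (a type in $\mathcal V^+$). A proposition $P$ is $\neg\neg$-stable if $\neg\neg P\to P$; $\Omega_{\neg\neg,\mathcal V}$ is the type of $\neg\neg$-stable propositions in $\mathcal V$. A type $X$ (in any universe) is $\mathcal V$-small if there is $Y:\mathcal V$ with $Y\simeq X$. A poset is a type $X$ with a proposition-valued reflexive, transitive, antisymmetric relation $\sqsubseteq$ (valued in some universe). It is $\delta_{\mathcal V}$-complete if for all $x\sqsubseteq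 y$ in $X$ and every proposition $P:\mathcal V$, the family $\delta_{x,y,P}:\mathbf 1+P\to X$ with $\mathrm{inl}(\star)\mapsto x$, $\mathrm{inr}(p)\mapsto y$ has a least upper bound $\bigvee\delta_{x,y,P}$. It is nontrivial if it comes with specified $x,y$ with $x\sqsubseteq y$ and $x\neq y$. For $x,y$ in a $\delta_{\mathcal V}$-complete poset, $x$ is strictly below $y$ ($x\sqsubset y$) if $x\sqsubseteq y$ and for every $z\sqsupseteq y$ and every proposition $P:\mathcal V$, $z=\bigvee\delta_{x,z,P}$ implies $P$. The poset is positive if it comes with specified $x,y$ with $x\sqsubset y$. It is locally small if each $x\sqsubseteq y$ is $\mathcal V$-small, and small if it is locally small and its carrier is $\mathcal V$-small. -}

{-# OPTIONS --without-K #-}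
module Defs where

open import Level using (Level; _⊔_; suc; Setω)
open import Data.Product using (Σ; Σ-syntax; _×_; _,_; proj₁; proj₂)
open import Data.Sum using (_⊎_; inj₁; inj₂)
open import Data.Unit using (⊤; tt)
open import Data.Empty using (⊥)
open import Relation.Nullary using (¬_)
open import Relation.Binary.PropositionalEquality using (_≡_)
open import Axiom.Extensionality.Propositional using (Extensionality)

isProp : ∀ {a} → Set a → Set a
isProp A = (x y : A) → x ≡ y

isEquiv : ∀ {a b} {A : Set a} {B : Set b} → (A → B) → Set (a ⊔ b)
isEquiv {A = A} {B} f =
  (Σ[ g ∈ (B → A) ] ((y : B) → f (g y) ≡ y)) ×
  (Σ[ h ∈ (B → A) ] ((x : A) → h (f x) ≡ x))

_≃_ : ∀ {a b} → Set a → Set b → Set (a ⊔ b)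
A ≃ B = Σ[ f ∈ (A → B) ] isEquiv f

isSmall : ∀ {a} (v : Level) → Set a → Set (a ⊔ suc v)
isSmall v X = Σ[ Y ∈ Set v ] (Y ≃ X)

FunExt : Setω
FunExt = ∀ {a b} → Extensionality a b

PropExt : Setω
PropExt = ∀ {a} {P Q : Set a} → isProp P → isProp Q → (P → Q) → (Q → P) → P ≡ Q

record Truncations : Setω where
  field
    ∥_∥      : ∀ {a} → Set a → Set a
    ∥∥-isProp : ∀ {a} {A : Set a} → isProp ∥ A ∥
    ∣_∣      : ∀ {a} {A : Set a} → A → ∥ A ∥
    ∥∥-rec   : ∀ {a b} {A : Set a} {Q : Set b} → isProp Q → (A → Q) → ∥ A ∥ → Q

Ω : (v : Level) → Set (suc v)
Ω v = Σ[ P ∈ Set v ] isProp P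

Ω¬¬ : (v : Level) → Set (suc v)
Ω¬¬ v = Σ[ P ∈ Set v ] (isProp P × (¬ ¬ P → P))

Ω-Resizing : (v : Level) → Set (suc v)
Ω-Resizing v = isSmall v (Ω v)

Ω¬¬-Resizing : (v : Level) → Set (suc v)
Ω¬¬-Resizing v = isSmall v (Ω¬¬ v)

record IsPoset {u t} {X : Set u} (_⊑_ : X → X → Set t) : Set (u ⊔ t) where
  field
    ⊑-prop    : ∀ x y → isProp (x ⊑ y)
    ⊑-refl    : ∀ x → x ⊑ x
    ⊑-trans   : ∀ x y z → x ⊑ y → y ⊑ z → x ⊑ z
    ⊑-antisym : ∀ x y → x ⊑ y → y ⊑ x → x ≡ y

module _ {u t} {X : Set u} (_⊑_ : X → X → Set t) where

  isSup : ∀ {i} {I : Set i} → (I → X) → X → Set (u ⊔ t ⊔ i)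
  isSup {I = I} α s = ((k : I) → α k ⊑ s) × ((w : X) → ((k : I) → α k ⊑ w) → s ⊑ w)

  HasSup : ∀ {i} {I : Set i} → (I → X) → Set (u ⊔ t ⊔ i)
  HasSup α = Σ[ s ∈ X ] isSup α s

  δ : ∀ {v} (x y : X) (P : Set v) → ⊤ ⊎ P → X
  δ x y P (inj₁ _) = x
  δ x y P (inj₂ _) = y

  -- δ_v-completeness (sups given as data)
  δComplete : (v : Level) → Set (u ⊔ t ⊔ suc v)
  δComplete v = (x y : X) → x ⊑ y → (P : Set v) → isProp P → HasSup (δ x y P)

  ⋁δ : ∀ {v} → δComplete v → (x y : X) → x ⊑ y → (P : Set v) → isProp P → X
  ⋁δ c x y l P i = proj₁ (c x y l P i)

  StrictlyBelow : ∀ {v} → (∀ x y z → x ⊑ y → y ⊑ z → x ⊑ z) → δComplete v → X → X → Set (u ⊔ t ⊔ suc v)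
  StrictlyBelow {v} tr c x y =
    Σ[ x⊑y ∈ x ⊑ y ]
      ((z : X) (y⊑z : y ⊑ z) (P : Set v) (i : isProp P) →
        z ≡ ⋁δ c x z (tr x y z x⊑y y⊑z) P i → P)

  isLocallySmall : (v : Level) → Set (u ⊔ t ⊔ suc v)
  isLocallySmall v = (x y : X) → isSmall v (x ⊑ y)

  isSmallPoset : (v : Level) → Set (u ⊔ t ⊔ suc v)
  isSmallPoset v = isLocallySmall v × isSmall v X

record SmallδCompletePoset (v : Level) : Setω where
  field
    u t      : Level
    Carrier  : Set u
    _⊑_      : Carrier → Carrier → Set t
    isPoset  : IsPoset _⊑_
    δcomplete : δComplete _⊑_ v
    small    : isSmallPoset _⊑_ v
  open IsPoset isPoset public

record NontrivialSmallδCompletePoset (v : Level) : Setω where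
  field
    poset : SmallδCompletePoset v
  open SmallδCompletePoset poset public
  field
    x₀ y₀   : Carrier
    x₀⊑y₀   : x₀ ⊑ y₀
    x₀≢y₀   : ¬ (x₀ ≡ y₀)

record PositiveSmallδCompletePoset (v : Level) : Setω where
  field
    poset : SmallδCompletePoset v
  open SmallδCompletePoset poset public
  field
    x₀ y₀   : Carrier
    x₀⊏y₀   : StrictlyBelow _⊑_ ⊑-trans δcomplete x₀ y₀

record _⇔ω_ (A : Setω) {b} (B : Set b) : Setω where
  field
    to   : A → B
    from : B → A

record _∧ω_ (A B : Setω) : Setω where
  field
    fst : A
    snd : B

-- If x ⊑ y, the map P ↦ ⋁ δ_{x,y,P} embeds propositions into the poset, and
-- z ↦ (y ⊑ z) is a retraction of it: P gives y ⊑ ⋁ δ_{x,y,P} directly, and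
-- conversely y ⊑ ⋁ δ_{x,y,P} gives P when x ⊏ y, but only ¬¬P when merely
-- x ≠ y (under ¬P the supremum collapses to x). A retract of a small poset is
-- small, so positivity resizes Ω and nontriviality resizes Ω¬¬. Conversely a
-- resized Ω (resp. Ω¬¬), ordered by implication, is itself such a poset, with
-- suprema ∥ P ⊎ (S × Q) ∥ (resp. ¬¬ (P ⊎ (S × Q))) and ⊥ ⊏ ⊤ (resp. ⊥ ≠ ⊤).
module Submission where

open import Defs
open import Level using (Level; Lift; lift; lower)
open import Data.Product using (Σ-syntax; _×_; _,_; proj₁; proj₂)
open import Data.Sum using (_⊎_; inj₁; inj₂)
open import Data.Unit using (⊤; tt)
open import Data.Empty using (⊥; ⊥-elim)
open import Relation.Nullary using (¬_)
open import Relation.Binary.PropositionalEquality using (_≡_; refl; sym; trans; cong; subst)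
open import Axiom.UniquenessOfIdentityProofs using (module Constant⇒UIP)

private
  variable
    a b u t v : Level

isProp⇒≡-irrelevant : {P : Set a} → isProp P → {x y : P} (p q : x ≡ y) → p ≡ q
isProp⇒≡-irrelevant P-prop = Constant⇒UIP.≡-irrelevant (λ {x} {y} _ → P-prop x y) (λ _ _ → refl)

isProp-isProp : {P : Set a} → FunExt → isProp (isProp P)
isProp-isProp fe p q = fe λ x → fe λ y → isProp⇒≡-irrelevant p (p x y) (q x y)

isProp-Π : {A : Set a} {B : A → Set b} → FunExt → ((x : A) → isProp (B x)) → isProp ((x : A) → B x)
isProp-Π fe B-prop f g = fe λ x → B-prop x (f x) (g x)

isProp-× : {A : Set a} {B : Set b} → isProp A → isProp B → isProp (A × B)
isProp-× A-prop B-prop (x , y) (x′ , y′) with A-prop x x′ | B-prop y y′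
... | refl | refl = refl

isProp-¬ : {A : Set a} → FunExt → isProp (¬ A)
isProp-¬ fe = isProp-Π fe (λ _ ())

Σ-≡-prop : {A : Set a} {B : A → Set b} → ((x : A) → isProp (B x)) →
  {x₁ x₂ : A} {y₁ : B x₁} {y₂ : B x₂} → x₁ ≡ x₂ → (x₁ , y₁) ≡ (x₂ , y₂)
Σ-≡-prop B-prop {y₁ = y₁} {y₂} refl = cong (_ ,_) (B-prop _ y₁ y₂)

≃-refl : {A : Set a} → A ≃ A
≃-refl = (λ x → x) , ((λ x → x) , λ _ → refl) , ((λ x → x) , λ _ → refl)

≃-inv : {A : Set a} {B : Set b} → A ≃ B → B → A
≃-inv (_ , (g , _) , _) = g

≃-inverseʳ : {A : Set a} {B : Set b} (e : A ≃ B) → ∀ y → proj₁ e (≃-inv e y) ≡ y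
≃-inverseʳ (_ , (_ , fg) , _) = fg

≃-inverseˡ : {A : Set a} {B : Set b} (e : A ≃ B) → ∀ x → ≃-inv e (proj₁ e x) ≡ x
≃-inverseˡ (f , (g , fg) , (h , hf)) x =
  trans (sym (hf (g (f x)))) (trans (cong h (fg (f x))) (hf x))

isProp-≃ : {A : Set a} {B : Set b} → A ≃ B → isProp B → isProp A
isProp-≃ e B-prop x y = trans (sym (≃-inverseˡ e x))
  (trans (cong (≃-inv e) (B-prop (proj₁ e x) (proj₁ e y))) (≃-inverseˡ e y))

¬¬-stable-¬ : {A : Set a} → ¬ ¬ ¬ A → ¬ A
¬¬-stable-¬ ¬¬¬a x = ¬¬¬a (λ ¬a → ¬a x)

-- The fixed points of s ∘ r are cut out of the small copy of X by C.
retract-isSmall : {X : Set u} {A : Set a} (s : A → X) (r : X → A) →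
  (∀ x → r (s x) ≡ x) → isSmall v X →
  (C : X → Set v) → (∀ z → isProp (C z)) →
  (∀ z → s (r z) ≡ z → C z) → (∀ z → C z → s (r z) ≡ z) → isSmall v A
retract-isSmall {v = v} {A = A} s r rs (Y , e) C C-prop fix⇒C C⇒fix =
  S , to , (from , to-from) , (from , from-to)
  where
  S : Set v
  S = Σ[ y ∈ Y ] C (proj₁ e y)

  to : S → A
  to (y , _) = r (proj₁ e y)

  from : A → S
  from x = ≃-inv e (s x) , subst C (sym (≃-inverseʳ e (s x))) (fix⇒C (s x) (cong s (rs x)))

  to-from : ∀ x → to (from x) ≡ x
  to-from x = trans (cong r (≃-inverseʳ e (s x))) (rs x)

  from-to : ∀ y → from (to y) ≡ y
  from-to (y , c) = Σ-≡-prop (λ y → C-prop (proj₁ e y))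
    (trans (cong (≃-inv e) (C⇒fix (proj₁ e y) c)) (≃-inverseˡ e y))

poset-retract-isSmall : {X : Set u} {_⊑_ : X → X → Set t} → IsPoset _⊑_ →
  isSmallPoset _⊑_ v → {A : Set a} (s : A → X) (r : X → A) →
  (∀ x → r (s x) ≡ x) → isSmall v A
poset-retract-isSmall {X = X} {_⊑_ = _⊑_} isPoset (⊑-small , X-small) s r rs =
  retract-isSmall s r rs X-small C C-prop fix⇒C C⇒fix
  where
  open IsPoset isPoset
  ⊑ₛ : X → X → Set _
  ⊑ₛ x y = proj₁ (⊑-small x y)

  ⊑ₛ≃⊑ : ∀ x y → ⊑ₛ x y ≃ (x ⊑ y)
  ⊑ₛ≃⊑ x y = proj₂ (⊑-small x y)

  C : X → Set _
  C z = ⊑ₛ (s (r z)) z × ⊑ₛ z (s (r z))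

  C-prop : ∀ z → isProp (C z)
  C-prop z = isProp-× (isProp-≃ (⊑ₛ≃⊑ _ _) (⊑-prop _ _)) (isProp-≃ (⊑ₛ≃⊑ _ _) (⊑-prop _ _))

  fix⇒C : ∀ z → s (r z) ≡ z → C z
  fix⇒C z e = ≃-inv (⊑ₛ≃⊑ _ _) (subst (s (r z) ⊑_) e (⊑-refl _))
            , ≃-inv (⊑ₛ≃⊑ _ _) (subst (_⊑ s (r z)) e (⊑-refl _))

  C⇒fix : ∀ z → C z → s (r z) ≡ z
  C⇒fix z (l , l′) = ⊑-antisym _ _ (proj₁ (⊑ₛ≃⊑ _ _) l) (proj₁ (⊑ₛ≃⊑ _ _) l′)

module δSup {X : Set u} {_⊑_ : X → X → Set t} (isPoset : IsPoset _⊑_)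
  (c : δComplete _⊑_ v) where
  open IsPoset isPoset

  module _ {x y : X} (x⊑y : x ⊑ y) {P : Set v} (P-prop : isProp P) where

    ⋁ : X
    ⋁ = ⋁δ _⊑_ c x y x⊑y P P-prop

    ⋁-upperˡ : x ⊑ ⋁
    ⋁-upperˡ = proj₁ (proj₂ (c x y x⊑y P P-prop)) (inj₁ tt)

    ⋁-upperʳ : P → y ⊑ ⋁
    ⋁-upperʳ p = proj₁ (proj₂ (c x y x⊑y P P-prop)) (inj₂ p)

    ⋁-least : ∀ w → x ⊑ w → (P → y ⊑ w) → ⋁ ⊑ w
    ⋁-least w x⊑w y⊑w = proj₂ (proj₂ (c x y x⊑y P P-prop)) w
      λ { (inj₁ _) → x⊑w ; (inj₂ p) → y⊑w p }

    ¬P⇒⋁⊑x : ¬ P → ⋁ ⊑ x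
    ¬P⇒⋁⊑x ¬p = ⋁-least x (⊑-refl x) (λ p → ⊥-elim (¬p p))

    x≢y⇒y⊑⋁⇒¬¬P : ¬ (x ≡ y) → y ⊑ ⋁ → ¬ ¬ P
    x≢y⇒y⊑⋁⇒¬¬P x≢y y⊑⋁ ¬p =
      x≢y (⊑-antisym x y x⊑y (⊑-trans y ⋁ x y⊑⋁ (¬P⇒⋁⊑x ¬p)))

  ⋁-absorb : {x y : X} (x⊑y : x ⊑ y) {P : Set v} (P-prop : isProp P) →
    y ⊑ ⋁ x⊑y P-prop → (x⊑⋁ : x ⊑ ⋁ x⊑y P-prop) →
    ⋁ x⊑y P-prop ≡ ⋁ x⊑⋁ P-prop
  ⋁-absorb x⊑y P-prop y⊑⋁ x⊑⋁ = ⊑-antisym _ _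
    (⋁-least x⊑y P-prop _ (⋁-upperˡ x⊑⋁ P-prop)
      (λ p → ⊑-trans _ _ _ y⊑⋁ (⋁-upperʳ x⊑⋁ P-prop p)))
    (⋁-least x⊑⋁ P-prop _ x⊑⋁ (λ _ → ⊑-refl _))

  ⊏⇒y⊑⋁⇒P : {x y : X} (x⊏y : StrictlyBelow _⊑_ ⊑-trans c x y) →
    {P : Set v} (P-prop : isProp P) → y ⊑ ⋁ (proj₁ x⊏y) P-prop → P
  ⊏⇒y⊑⋁⇒P {x} {y} (x⊑y , strict) {P} P-prop y⊑⋁ =
    strict _ y⊑⋁ P P-prop (⋁-absorb x⊑y P-prop y⊑⋁ (⊑-trans x y _ x⊑y y⊑⋁))

Ω-≡ : FunExt → PropExt → {P Q : Ω v} → (proj₁ P → proj₁ Q) → (proj₁ Q → proj₁ P) → P ≡ Q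
Ω-≡ fe pe {_ , P-prop} {_ , Q-prop} f g =
  Σ-≡-prop (λ _ → isProp-isProp fe) (pe P-prop Q-prop f g)

Ω¬¬-≡ : FunExt → PropExt → {P Q : Ω¬¬ v} → (proj₁ P → proj₁ Q) → (proj₁ Q → proj₁ P) → P ≡ Q
Ω¬¬-≡ fe pe {_ , P-prop , _} {_ , Q-prop , _} f g =
  Σ-≡-prop isProp-isProp×stable (pe P-prop Q-prop f g)
  where
  isProp-isProp×stable : (A : Set _) → isProp (isProp A × (¬ ¬ A → A))
  isProp-isProp×stable A w@(A-prop , _) =
    isProp-× (isProp-isProp fe) (isProp-Π fe (λ _ → A-prop)) w

¬¬Ω : FunExt → Set v → Ω¬¬ v
¬¬Ω fe A = (¬ ¬ A) , isProp-¬ fe , ¬¬-stable-¬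

implication-isPoset : FunExt → {A : Set a} (El : A → Set v) → (∀ P → isProp (El P)) →
  (∀ {P Q} → (El P → El Q) → (El Q → El P) → P ≡ Q) →
  IsPoset (λ P Q → El P → El Q)
implication-isPoset fe El El-prop El-ext = record
  { ⊑-prop    = λ _ Q → isProp-Π fe (λ _ → El-prop Q)
  ; ⊑-refl    = λ _ p → p
  ; ⊑-trans   = λ _ _ _ f g p → g (f p)
  ; ⊑-antisym = λ _ _ → El-ext
  }

Ω¬¬-poset : FunExt → PropExt → Ω¬¬-Resizing v → SmallδCompletePoset v
Ω¬¬-poset {v} fe pe R = record
  { Carrier   = Ω¬¬ v
  ; _⊑_       = λ P Q → proj₁ P → proj₁ Q
  ; isPoset   = implication-isPoset fe proj₁ (λ P → proj₁ (proj₂ P)) (Ω¬¬-≡ fe pe)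
  ; δcomplete = λ P Q _ S _ →
      ¬¬Ω fe (proj₁ P ⊎ (S × proj₁ Q))
      , (λ { (inj₁ _) p k → k (inj₁ p) ; (inj₂ s) q k → k (inj₂ (s , q)) })
      , λ W h ¬¬sup → proj₂ (proj₂ W) λ ¬w → ¬¬sup
          λ { (inj₁ p) → ¬w (h (inj₁ tt) p) ; (inj₂ (s , q)) → ¬w (h (inj₂ s) q) }
  ; small     = (λ _ _ → _ , ≃-refl) , R
  }

Ω-poset : FunExt → PropExt → Truncations → Ω-Resizing v → SmallδCompletePoset v
Ω-poset {v} fe pe T R = record
  { Carrier   = Ω v
  ; _⊑_       = λ P Q → proj₁ P → proj₁ Q
  ; isPoset   = implication-isPoset fe proj₁ proj₂ (Ω-≡ fe pe)
  ; δcomplete = λ P Q _ S _ →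
      (∥ proj₁ P ⊎ (S × proj₁ Q) ∥ , ∥∥-isProp)
      , (λ { (inj₁ _) p → ∣ inj₁ p ∣ ; (inj₂ s) q → ∣ inj₂ (s , q) ∣ })
      , λ W h → ∥∥-rec (proj₂ W)
          λ { (inj₁ p) → h (inj₁ tt) p ; (inj₂ (s , q)) → h (inj₂ s) q }
  ; small     = (λ _ _ → _ , ≃-refl) , R
  }
  where open Truncations T

Ω¬¬-Resizing⇒nontrivial : FunExt → PropExt → Ω¬¬-Resizing v → NontrivialSmallδCompletePoset v
Ω¬¬-Resizing⇒nontrivial {v} fe pe R = record
  { poset = Ω¬¬-poset fe pe R
  ; x₀    = Lift v ⊥ , (λ ()) , λ ¬¬⊥ → ⊥-elim (¬¬⊥ λ ())
  ; y₀    = Lift v ⊤ , (λ _ _ → refl) , (λ _ → lift tt)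
  ; x₀⊑y₀ = λ _ → lift tt
  ; x₀≢y₀ = λ ⊥≡⊤ → lower (subst proj₁ (sym ⊥≡⊤) (lift tt))
  }

Ω-Resizing⇒positive : FunExt → PropExt → Truncations → Ω-Resizing v → PositiveSmallδCompletePoset v
Ω-Resizing⇒positive {v} fe pe T R = record
  { poset = Ω-poset fe pe T R
  ; x₀    = Lift v ⊥ , λ ()
  ; y₀    = Lift v ⊤ , λ _ _ → refl
  ; x₀⊏y₀ = (λ _ → lift tt) , λ Z ⊤⊑Z S S-prop Z≡sup →
      ∥∥-rec S-prop (λ { (inj₁ ()) ; (inj₂ (s , _)) → s })
        (subst proj₁ Z≡sup (⊤⊑Z (lift tt)))
  }
  where open Truncations T

nontrivial⇒Ω¬¬-Resizing : FunExt → PropExt → NontrivialSmallδCompletePoset v → Ω¬¬-Resizing v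
nontrivial⇒Ω¬¬-Resizing fe pe N = poset-retract-isSmall isPoset small sup r r∘sup
  where
  open NontrivialSmallδCompletePoset N
  open δSup isPoset δcomplete

  sup : Ω¬¬ _ → Carrier
  sup (_ , P-prop , _) = ⋁ x₀⊑y₀ P-prop

  y₀⊑ₛ : Carrier → Set _
  y₀⊑ₛ z = proj₁ (proj₁ small y₀ z)

  y₀⊑ₛ≃ : ∀ z → y₀⊑ₛ z ≃ (y₀ ⊑ z)
  y₀⊑ₛ≃ z = proj₂ (proj₁ small y₀ z)

  r : Carrier → Ω¬¬ _
  r z = ¬¬Ω fe (y₀⊑ₛ z)

  r∘sup : ∀ P → r (sup P) ≡ P
  r∘sup (P , P-prop , P-stable) = Ω¬¬-≡ fe pe
    (λ ¬¬y₀⊑ → P-stable λ ¬p → ¬¬y₀⊑ λ l →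
      x≢y⇒y⊑⋁⇒¬¬P x₀⊑y₀ P-prop x₀≢y₀ (proj₁ (y₀⊑ₛ≃ _) l) ¬p)
    (λ p ¬y₀⊑ → ¬y₀⊑ (≃-inv (y₀⊑ₛ≃ _) (⋁-upperʳ x₀⊑y₀ P-prop p)))

positive⇒Ω-Resizing : FunExt → PropExt → PositiveSmallδCompletePoset v → Ω-Resizing v
positive⇒Ω-Resizing fe pe N = poset-retract-isSmall isPoset small sup r r∘sup
  where
  open PositiveSmallδCompletePoset N
  open δSup isPoset δcomplete

  sup : Ω _ → Carrier
  sup (_ , P-prop) = ⋁ (proj₁ x₀⊏y₀) P-prop

  y₀⊑ₛ : Carrier → Set _
  y₀⊑ₛ z = proj₁ (proj₁ small y₀ z)

  y₀⊑ₛ≃ : ∀ z → y₀⊑ₛ z ≃ (y₀ ⊑ z)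
  y₀⊑ₛ≃ z = proj₂ (proj₁ small y₀ z)

  r : Carrier → Ω _
  r z = y₀⊑ₛ z , isProp-≃ (y₀⊑ₛ≃ z) (⊑-prop y₀ z)

  r∘sup : ∀ P → r (sup P) ≡ P
  r∘sup (P , P-prop) = Ω-≡ fe pe
    (λ l → ⊏⇒y⊑⋁⇒P x₀⊏y₀ P-prop (proj₁ (y₀⊑ₛ≃ _) l))
    (λ p → ≃-inv (y₀⊑ₛ≃ _) (⋁-upperʳ (proj₁ x₀⊏y₀) P-prop p))

mainTheorem1 : FunExt → PropExt → Truncations → ∀ v →
    ((NontrivialSmallδCompletePoset v ⇔ω Ω¬¬-Resizing v) ∧ω (PositiveSmallδCompletePoset v ⇔ω Ω-Resizing v))
mainTheorem1 fe pe T v = record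
  { fst = record { to = nontrivial⇒Ω¬¬-Resizing fe pe ; from = Ω¬¬-Resizing⇒nontrivial fe pe }
  ; snd = record { to = positive⇒Ω-Resizing fe pe ; from = Ω-Resizing⇒positive fe pe T }
  }
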